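{- Let $\mathcal{H}$ be a $3$-partite $3$-graph that has a matchable FR-partition $(\mathcal{F},\mathcal{R},W)$. Let $a,b,c\in V(\mathcal{H})$ lie in three different vertex classes. Suppose that (1) for every $F\in\mathcal{F}$ there is an edge of $\mathcal{H}|_F$ avoiding $\{a,b,c\}$, and (2) for every $R\in\mathcal{R}$ there is an edge of $\mathcal{H}$ containing two vertices of $R$ and avoiding $\{a,b,c\}$. Then $\nu(\mathcal{H}-\{a,b,c\})=\nu(\mathcal{H})$.
   Context: Hypergraphs have a finite vertex set and a multiset of edges; parallel edges are edges with the same vertex set. A $3$-partite $3$-graph has vertex classes $V_1,V_2,V_3$ partitioning the vertices, each edge having one vertex in each class. $\nu$ is the matching number. $\mathcal{H}|_U$ is the hypergraph of all edges contained in $U$; $\mathcal{H}-U$ is obtained by deleting the vertices of $U$ and all edges meeting $U$. The truncated Fano plane is the $3$-graph on $\{a,b,c,x,y,z\}$ with edges $abc,ayz,xbz,xyc$; a truncated multi-Fano plane is obtained from it by adding edges parallel to existing ones. An FR-partition of $\mathcal{H}$ is a triple $(\mathcal{F},\mathcal{R},W)$ with (1) $\mathcal{F}\cup\mathcal{R}\cup\{W\}$ a partition of $V(\mathcal{H})$; (2) $\mathcal{H}|_F$ isomorphic to a truncated multi-Fano plane for every $F\in\mathcal{F}$; (3) every $R\in\mathcal{R}$ a $3$-set with one vertex from each class; (4) $|\mathcal{F}\cup\mathcal{R}|=\nu(\mathcal{H})$. $B_i$ is the bipartite graph with classes $\mathcal{R}$ and $W\cap V_i$, where $R\sim w$ iff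 some edge of $\mathcal{H}$ contains $w$ and two vertices of $R$. The FR-partition is matchable if each $B_i$ ($i=1,2,3$) has a matching saturating $\mathcal{R}$. -}

module Defs where

open import Level using (0ℓ)
open import Data.Nat using (ℕ; _≤_; _+_)
open import Data.Fin using (Fin; zero; suc)
open import Data.Fin.Properties using (_≟_; all?)
open import Data.Product using (Σ; ∃; _×_; _,_)
open import Data.List using (List; []; _∷_; length; filter; map; _++_)
open import Data.List.Membership.Propositional using (_∈_; _∉_)
import Data.List.Membership.DecPropositional
open import Data.List.Relation.Unary.All as All using (All)
open import Data.List.Relation.Unary.All.Properties using (all-filter; filter⁺)
open import Data.List.Relation.Unary.Any using (Any)
open import Data.List.Relation.Unary.AllPairs using (AllPairs)
open import Data.List.Relation.Binary.Sublist.Propositional using (_⊆_)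
open import Relation.Binary.PropositionalEquality using (_≡_; _≢_)
open import Relation.Nullary using (¬_; Dec; ¬?)
open import Relation.Unary using (Pred; Decidable)
open import Function.Bundles using (_⇔_)
open import Function.Definitions using (Injective)

-- Vertices live in the finite universe Fin n; the vertex set V(H) is a
-- predicate on Fin n.  Every vertex v gets a class  cls v : Fin 3, so the
-- vertex classes are V_i = { v ∈ V(H) | cls v ≡ i }, a partition of V(H).
-- An edge of a 3-partite 3-graph has exactly one vertex in each class, so
-- it is encoded as a map  e : Fin 3 → Fin n  with  cls (e i) ≡ i ;
-- its vertex set is { e 0 , e 1 , e 2 }.
-- The edges form a multiset, encoded as a list (repetitions = parallel
-- edges).

Edge : ℕ → Set
Edge n = Fin 3 → Fin n

record Tri3Graph (n : ℕ) : Set₁ where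
  field
    V        : Pred (Fin n) 0ℓ
    cls      : Fin n → Fin 3
    E        : List (Edge n)
    edgesIn  : All (λ e → ∀ i → V (e i)) E
    edgesCls : All (λ e → ∀ i → cls (e i) ≡ i) E
open Tri3Graph public

_∈ₑ_ : ∀ {n} → Fin n → Edge n → Set
v ∈ₑ e = ∃ λ i → e i ≡ v

Disjoint : ∀ {n} → Edge n → Edge n → Set
Disjoint e f = ∀ i j → e i ≢ f j

IsMatching : ∀ {n} → Tri3Graph n → List (Edge n) → Set
IsMatching H M = (M ⊆ E H) × AllPairs Disjoint M

MatchingNumber : ∀ {n} → Tri3Graph n → ℕ → Set
MatchingNumber H k =
  (∃ λ M → IsMatching H M × length M ≡ k) ×
  (∀ M → IsMatching H M → length M ≤ k)

Avoids : ∀ {n} → List (Fin n) → Edge n → Set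
Avoids U e = ∀ i → e i ∉ U

avoids? : ∀ {n} (U : List (Fin n)) → Decidable (Avoids U)
avoids? {n} U e = all? (λ i → ¬? (DM._∈?_ (e i) U))
  where module DM = Data.List.Membership.DecPropositional (_≟_ {n})

_−_ : ∀ {n} → Tri3Graph n → List (Fin n) → Tri3Graph n
H − U = record
  { V        = λ v → V H v × v ∉ U
  ; cls      = cls H
  ; E        = filter (avoids? U) (E H)
  ; edgesIn  = All.zipWith (λ { (inV , av) i → inV i , av i })
                 (filter⁺ (avoids? U) (edgesIn H) , all-filter (avoids? U) (E H))
  ; edgesCls = filter⁺ (avoids? U) (edgesCls H)
  }

_⊆ₑ_ : ∀ {n} → Edge n → Pred (Fin n) 0ℓ → Set
e ⊆ₑ F = ∀ i → F (e i)

SameVertices : ∀ {n} → Edge n → Edge n → Set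
SameVertices e f = ∀ v → (v ∈ₑ e) ⇔ (v ∈ₑ f)

fanoEdges : List (Edge 6)
fanoEdges = abc ∷ ayz ∷ xbz ∷ xyc ∷ []
  where
  a b c x y z : Fin 6
  a = zero
  b = suc zero
  c = suc (suc zero)
  x = suc (suc (suc zero))
  y = suc (suc (suc (suc zero)))
  z = suc (suc (suc (suc (suc zero))))
  mk : Fin 6 → Fin 6 → Fin 6 → Edge 6
  mk p q r zero = p
  mk p q r (suc zero) = q
  mk p q r (suc (suc zero)) = r
  abc ayz xbz xyc : Edge 6
  abc = mk a b c
  ayz = mk a y z
  xbz = mk x b z
  xyc = mk x y c

IsTruncMultiFano : ∀ {n} → Tri3Graph n → Pred (Fin n) 0ℓ → Set
IsTruncMultiFano {n} H F =
  Σ (Fin 6 → Fin n) λ f →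
    Injective _≡_ _≡_ f ×
    (∀ v → F v ⇔ (∃ λ k → f k ≡ v)) ×
    All (λ e → e ⊆ₑ F → Any (λ t → SameVertices e (λ i → f (t i))) fanoEdges) (E H) ×
    All (λ t → Any (λ e → SameVertices e (λ i → f (t i))) (E H)) fanoEdges

-- the vertex set of an R ∈ 𝓡 (encoded like an edge)
tripleSet : ∀ {n} → Edge n → Pred (Fin n) 0ℓ
tripleSet r v = v ∈ₑ r

IsPartition : ∀ {n} → Pred (Fin n) 0ℓ → List (Pred (Fin n) 0ℓ) → Set₁
IsPartition {n} V parts =
  All (λ P → ∀ v → P v → V v) parts ×
  AllPairs (λ P Q → ∀ v → P v → Q v → Data.Empty.⊥) parts ×
  (∀ v → V v → Any (λ P → P v) parts)
  where import Data.Empty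

record FRPartition {n : ℕ} (H : Tri3Graph n) : Set₁ where
  field
    𝓕 : List (Pred (Fin n) 0ℓ)
    𝓡 : List (Edge n)
    W : Pred (Fin n) 0ℓ
    partition : IsPartition (V H) (𝓕 ++ map tripleSet 𝓡 ++ W ∷ [])
    fano      : All (IsTruncMultiFano H) 𝓕
    rClasses  : All (λ r → ∀ i → cls H (r i) ≡ i) 𝓡
    size      : MatchingNumber H (length 𝓕 + length 𝓡)
open FRPartition public

ContainsTwo : ∀ {n} → Edge n → Edge n → Set
ContainsTwo e r = ∃ λ p → ∃ λ q → p ≢ q × (r p ∈ₑ e) × (r q ∈ₑ e)

Adj : ∀ {n} → Tri3Graph n → Edge n → Fin n → Set
Adj H r w = Any (λ e → (w ∈ₑ e) × ContainsTwo e r) (E H)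

-- B_i has a matching saturating 𝓡: an injective assignment of vertices
-- of W ∩ V_i to the members of 𝓡 along edges of B_i.
Saturating : ∀ {n} (H : Tri3Graph n) → FRPartition H → Fin 3 → Set
Saturating {n} H P i =
  Σ (Fin (length (𝓡 P)) → Fin n) λ σ →
    Injective _≡_ _≡_ σ ×
    (∀ j → W P (σ j) × V H (σ j) × cls H (σ j) ≡ i ×
           Adj H (Data.List.lookup (𝓡 P) j) (σ j))

Matchable : ∀ {n} (H : Tri3Graph n) → FRPartition H → Set
Matchable H P = ∀ i → Saturating H P i

-- Since H − U is a subhypergraph of H, ν(H − U) ≤ ν(H) = |𝓕| + |𝓡|, so it
-- suffices to find |𝓕| + |𝓡| disjoint edges avoiding U = {a, b, c}: one inside
-- each F ∈ 𝓕 and, for each R ∈ 𝓡, one of the form R[i ↦ x] (R with its vertex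
-- of class i replaced by x).  Let τᵢ be the matching of B_i; the edge through
-- τᵢ(R) witnessing R ∼ τᵢ(R) is R[i ↦ τᵢ(R)], because τᵢ(R) ∈ W.  If every R
-- has a class i such that R avoids U outside class i and τᵢ(R) ∉ U, these
-- edges, with those given by (1), are pairwise disjoint.  Otherwise some R₀
-- has no such class.  Hypothesis (2) gives an edge R₀[i ↦ w] avoiding U, and
-- then badness of R₀ forces R₀ ∩ U = ∅ and {τ₁(R₀), τ₂(R₀), τ₃(R₀)} = U, so
-- U ⊆ W.  Now use R₀[i ↦ w] for R₀, an edge R[c ↦ τ_c(R)] with τ_c(R) ≠ w for
-- every other R, and inside each F an edge missing w, which exists because
-- every vertex of the truncated Fano plane misses one of its lines.
module Submission where

open import Defs
open import Level using (Level; 0ℓ)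
open import Data.Nat using (ℕ; suc; _+_)
open import Data.Nat.Properties using (≤-antisym)
open import Data.Fin using (Fin; zero; suc; punchIn; splitAt; join)
open import Data.Fin.Properties using (_≟_; any?; all?; ¬∀⟶∃¬; punchInᵢ≢i; join-splitAt)
open import Data.Product using (Σ; ∃; _×_; _,_; proj₁; proj₂)
open import Data.Sum using (_⊎_; inj₁; inj₂; [_,_]′)
open import Data.Empty using (⊥; ⊥-elim)
open import Data.List using (List; []; _∷_; _++_; length; map; lookup)
open import Data.List.Properties using (length-tabulate)
open import Data.List.Relation.Unary.All as All using (All; []; _∷_)
import Data.List.Relation.Unary.All.Properties as AllP
open import Data.List.Relation.Unary.Any as Any using (Any; here; there)
open import Data.List.Relation.Unary.AllPairs using (AllPairs; []; _∷_)
import Data.List.Relation.Unary.AllPairs.Properties as AllPairsP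
open import Data.List.Relation.Binary.Sublist.Propositional using (_⊆_; _∷_; _∷ʳ_; minimum; ⊆-trans)
open import Data.List.Relation.Binary.Sublist.Propositional.Properties using (filter-⊆)
open import Data.List.Membership.Propositional using (_∈_; _∉_; find)
open import Data.List.Membership.Propositional.Properties using (∈-lookup; ∈-filter⁺)
import Data.List.Membership.DecPropositional as DecMembership
open import Relation.Binary.PropositionalEquality using (_≡_; _≢_; refl; sym; trans; cong; subst; subst₂)
open import Relation.Nullary using (¬_; Dec; yes; no)
open import Relation.Nullary.Decidable using (_×-dec_; _→-dec_; ¬?)
open import Relation.Unary using (Pred)
open import Function.Base using (_∘_; id)
open import Function.Bundles using (Equivalence)
open import Function.Definitions using (Injective)

private
  variable
    a b ℓ : Level
    A : Set a
    B : Set b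

lookup-All : {P : Pred A ℓ} {xs : List A} → All P xs → ∀ i → P (lookup xs i)
lookup-All pxs i = All.lookup pxs (∈-lookup i)

AllPairs-++⁻ : {R : A → A → Set ℓ} (xs : List A) {ys : List A} → AllPairs R (xs ++ ys) →
  AllPairs R xs × AllPairs R ys × All (λ x → All (R x) ys) xs
AllPairs-++⁻ []       pxs        = [] , pxs , []
AllPairs-++⁻ (x ∷ xs) (px ∷ pxs) =
  let rxs , rys , rxys = AllPairs-++⁻ xs pxs
  in AllP.++⁻ˡ xs px ∷ rxs , rys , AllP.++⁻ʳ xs px ∷ rxys

disjoint⇒lookup-unique : (P : A → Pred B ℓ) {xs : List A} →
  AllPairs (λ x y → ∀ v → P x v → P y v → ⊥) xs →
  ∀ {v} i j → P (lookup xs i) v → P (lookup xs j) v → i ≡ j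
disjoint⇒lookup-unique P (_ ∷ _)  zero    zero    _  _  = refl
disjoint⇒lookup-unique P (d ∷ _)  zero    (suc j) pv qv = ⊥-elim (lookup-All d j _ pv qv)
disjoint⇒lookup-unique P (d ∷ _)  (suc i) zero    pv qv = ⊥-elim (lookup-All d i _ qv pv)
disjoint⇒lookup-unique P (_ ∷ ds) (suc i) (suc j) pv qv = cong suc (disjoint⇒lookup-unique P ds i j pv qv)

AllPairs-≢⇒injective : (f : A → B) {xs : List A} → AllPairs (λ x y → f x ≢ f y) xs →
  ∀ {x y} → x ∈ xs → y ∈ xs → f x ≡ f y → x ≡ y
AllPairs-≢⇒injective f (_ ∷ _)  (here refl) (here refl) _  = refl
AllPairs-≢⇒injective f (d ∷ _)  (here refl) (there y∈)  eq = ⊥-elim (All.lookup d y∈ eq)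
AllPairs-≢⇒injective f (d ∷ _)  (there x∈)  (here refl) eq = ⊥-elim (All.lookup d x∈ (sym eq))
AllPairs-≢⇒injective f (_ ∷ ds) (there x∈)  (there y∈)  eq = AllPairs-≢⇒injective f ds x∈ y∈ eq

module _ {R : A → A → Set ℓ} (R-sym : ∀ {x y} → R x y → R y x) (R-irrefl : ∀ {x} → ¬ R x x) where

  private
    Realises : List A → List A → List A → Set _
    Realises ys xs zs = zs ⊆ ys × AllPairs R zs × length zs ≡ length xs ×
                        (∀ {Q : Pred A ℓ} → All Q xs → All Q zs)

    insert : ∀ {x xs ys} → xs ⊆ ys → AllPairs R xs → x ∈ ys → All (R x) xs → ∃ (Realises ys (x ∷ xs))
    insert (y ∷ʳ xs⊆) pxs (here refl) rx = _ , refl ∷ xs⊆ , rx ∷ pxs , refl , id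
    insert (refl ∷ _) _ (here refl) (r ∷ _) = ⊥-elim (R-irrefl r)
    insert (y ∷ʳ xs⊆) pxs (there x∈) rx =
      let zs , zs⊆ , pzs , len , keep = insert xs⊆ pxs x∈ rx
      in zs , y ∷ʳ zs⊆ , pzs , len , keep
    insert (refl ∷ xs⊆) (py ∷ pxs) (there x∈) (rxy ∷ rx) =
      let zs , zs⊆ , pzs , len , keep = insert xs⊆ pxs x∈ rx
      in _ , refl ∷ zs⊆ , keep (R-sym rxy ∷ py) ∷ pzs , cong suc len ,
         λ { (qx ∷ qy ∷ qxs) → qy ∷ keep (qx ∷ qxs) }

    realise : ∀ {xs ys} → All (_∈ ys) xs → AllPairs R xs → ∃ (Realises ys xs)
    realise [] [] = [] , minimum _ , [] , refl , id
    realise (x∈ ∷ xs∈) (rx ∷ pxs) =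
      let zs , zs⊆ , pzs , len , keep = realise xs∈ pxs
          zs′ , zs′⊆ , pzs′ , len′ , keep′ = insert zs⊆ pzs x∈ (keep rx)
      in zs′ , zs′⊆ , pzs′ , trans len′ (cong suc len) , λ { (qx ∷ qxs) → keep′ (qx ∷ keep qxs) }

  -- zs is xs reordered along ys; irreflexivity of R prevents two entries of xs
  -- from being the same entry of ys.
  AllPairs-∈⇒⊆ : ∀ {xs ys} → All (_∈ ys) xs → AllPairs R xs →
    ∃ λ zs → zs ⊆ ys × AllPairs R zs × length zs ≡ length xs
  AllPairs-∈⇒⊆ xs∈ pxs = let zs , zs⊆ , pzs , len , _ = realise xs∈ pxs in zs , zs⊆ , pzs , len

third-class : (p q : Fin 3) → p ≢ q → ∃ λ i → ∀ t → t ≢ i → t ≡ p ⊎ t ≡ q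
third-class zero zero p≢q = ⊥-elim (p≢q refl)
third-class zero (suc zero) _ = suc (suc zero) ,
  λ { zero _ → inj₁ refl ; (suc zero) _ → inj₂ refl ; (suc (suc zero)) t≢i → ⊥-elim (t≢i refl) }
third-class zero (suc (suc zero)) _ = suc zero ,
  λ { zero _ → inj₁ refl ; (suc zero) t≢i → ⊥-elim (t≢i refl) ; (suc (suc zero)) _ → inj₂ refl }
third-class (suc zero) zero _ = suc (suc zero) ,
  λ { zero _ → inj₂ refl ; (suc zero) _ → inj₁ refl ; (suc (suc zero)) t≢i → ⊥-elim (t≢i refl) }
third-class (suc zero) (suc zero) p≢q = ⊥-elim (p≢q refl)
third-class (suc zero) (suc (suc zero)) _ = zero ,
  λ { zero t≢i → ⊥-elim (t≢i refl) ; (suc zero) _ → inj₁ refl ; (suc (suc zero)) _ → inj₂ refl }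
third-class (suc (suc zero)) zero _ = suc zero ,
  λ { zero _ → inj₂ refl ; (suc zero) t≢i → ⊥-elim (t≢i refl) ; (suc (suc zero)) _ → inj₁ refl }
third-class (suc (suc zero)) (suc zero) _ = zero ,
  λ { zero t≢i → ⊥-elim (t≢i refl) ; (suc zero) _ → inj₂ refl ; (suc (suc zero)) _ → inj₁ refl }
third-class (suc (suc zero)) (suc (suc zero)) p≢q = ⊥-elim (p≢q refl)

Transversal : ∀ {n} → (Fin n → Fin 3) → Edge n → Set
Transversal cls e = ∀ i → cls (e i) ≡ i

edge-transversal : ∀ {n} (H : Tri3Graph n) {e} → e ∈ E H → Transversal (cls H) e
edge-transversal H = All.lookup (edgesCls H)

module _ {n} (cls : Fin n → Fin 3) where

  transversal-at : ∀ {e} → Transversal cls e → ∀ {s x t} → e s ≡ x → cls x ≡ t → e t ≡ x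
  transversal-at tr {s} es≡x clsx≡t with trans (sym (tr s)) (trans (cong cls es≡x) clsx≡t)
  ... | refl = es≡x

  ContainsTwo⇒agrees-off-one : ∀ {e r} → Transversal cls e → Transversal cls r → ContainsTwo e r →
    ∃ λ i → ∀ t → t ≢ i → e t ≡ r t
  ContainsTwo⇒agrees-off-one {e} {r} tr-e tr-r (p , q , p≢q , (_ , e≡rp) , (_ , e≡rq)) =
    let i , p-or-q = third-class p q p≢q in i , λ t t≢i → agree t (p-or-q t t≢i)
    where
    agree : ∀ t → t ≡ p ⊎ t ≡ q → e t ≡ r t
    agree t (inj₁ refl) = transversal-at tr-e e≡rp (tr-r t)
    agree t (inj₂ refl) = transversal-at tr-e e≡rq (tr-r t)

infix 4 _≗_[_↦_]
_≗_[_↦_] : ∀ {n} → Edge n → Edge n → Fin 3 → Fin n → Set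
e ≗ r [ i ↦ x ] = (∀ t → t ≢ i → e t ≡ r t) × e i ≡ x

replacement-avoids : ∀ {n} (U : List (Fin n)) {e r i x} → e ≗ r [ i ↦ x ] →
  (∀ t → t ≢ i → r t ∉ U) → x ∉ U → Avoids U e
replacement-avoids U {i = i} (agree , ei≡x) r-avoids x∉U t with t ≟ i
... | yes refl = subst (_∉ U) (sym ei≡x) x∉U
... | no t≢i   = subst (_∉ U) (sym (agree t t≢i)) (r-avoids t t≢i)

fano-line-avoiding : ∀ k → Any (λ t → ∀ u → t u ≢ k) fanoEdges
fano-line-avoiding zero = there (there (here λ { zero () ; (suc zero) () ; (suc (suc zero)) () }))
fano-line-avoiding (suc zero) = there (here λ { zero () ; (suc zero) () ; (suc (suc zero)) () })
fano-line-avoiding (suc (suc zero)) = there (here λ { zero () ; (suc zero) () ; (suc (suc zero)) () })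
fano-line-avoiding (suc (suc (suc _))) = here λ { zero () ; (suc zero) () ; (suc (suc zero)) () }

truncMultiFano-avoiding : ∀ {n} {H : Tri3Graph n} {F} → IsTruncMultiFano H F →
  ∀ v → ∃ λ e → e ∈ E H × e ⊆ₑ F × ∀ s → e s ≢ v
truncMultiFano-avoiding {n} {H} {F} (f , f-injective , F⇔ , _ , lines) v =
  e , proj₁ (proj₂ found) , (λ s → Equivalence.from (F⇔ (e s)) (_ , proj₂ (vertex s))) , avoids
  where
  line-missing-v : ∃ λ t → Any (λ e → SameVertices e (λ i → f (t i))) (E H) × ∀ u → f (t u) ≢ v
  line-missing-v with any? (λ k → f k ≟ v)
  ... | yes (k , fk≡v) =
    let line , t∌k = All.lookupAny lines (fano-line-avoiding k)
    in Any.lookup (fano-line-avoiding k) , line ,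
       λ u ftu≡v → t∌k u (f-injective (trans ftu≡v (sym fk≡v)))
  ... | no ∄k = _ , All.head lines , λ u ftu≡v → ∄k (_ , ftu≡v)
  t : Edge 6
  t = proj₁ line-missing-v
  found : ∃ λ e → e ∈ E H × SameVertices e (λ i → f (t i))
  found = find (proj₁ (proj₂ line-missing-v))
  e : Edge n
  e = proj₁ found
  vertex : ∀ s → ∃ λ u → f (t u) ≡ e s
  vertex s = Equivalence.to (proj₂ (proj₂ found) (e s)) (s , refl)
  avoids : ∀ s → e s ≢ v
  avoids s es≡v = let u , ftu≡es = vertex s in proj₂ (proj₂ line-missing-v) u (trans ftu≡es es≡v)

Disjoint-sym : ∀ {n} {e f : Edge n} → Disjoint e f → Disjoint f e
Disjoint-sym d i j eq = d j i (sym eq)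

Disjoint-irrefl : ∀ {n} {e : Edge n} → ¬ Disjoint e e
Disjoint-irrefl d = d zero zero refl

family-matching : ∀ {n m} (H : Tri3Graph n) (e : Fin m → Edge n) → (∀ i → e i ∈ E H) →
  (∀ {i j} → i ≢ j → Disjoint (e i) (e j)) → ∃ λ M → IsMatching H M × length M ≡ m
family-matching H e e∈ disjoint =
  let M , M⊆ , pM , len = AllPairs-∈⇒⊆ Disjoint-sym Disjoint-irrefl
                            (AllP.tabulate⁺ e∈) (AllPairsP.tabulate⁺ disjoint)
  in M , (M⊆ , pM) , trans len (length-tabulate e)

MatchingNumber-unique : ∀ {n} {H : Tri3Graph n} {k l} → MatchingNumber H k → MatchingNumber H l → k ≡ l
MatchingNumber-unique ((M , isM , refl) , ≤k) ((M′ , isM′ , refl) , ≤l) = ≤-antisym (≤l M isM) (≤k M′ isM′)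

MatchingNumber-− : ∀ {n} {H : Tri3Graph n} {U k} → MatchingNumber H k →
  (∃ λ M → IsMatching (H − U) M × length M ≡ k) → MatchingNumber (H − U) k
MatchingNumber-− {U = U} (_ , ≤k) M =
  M , λ { M′ (M′⊆ , disjoint) → ≤k M′ (⊆-trans M′⊆ (filter-⊆ (avoids? U) _) , disjoint) }

module FRPartitionFacts {n} {H : Tri3Graph n} (P : FRPartition H) where

  nF nR : ℕ
  nF = length (𝓕 P)
  nR = length (𝓡 P)

  F : Fin nF → Pred (Fin n) 0ℓ
  F = lookup (𝓕 P)

  R : Fin nR → Edge n
  R = lookup (𝓡 P)

  private
    Apart : Pred (Fin n) 0ℓ → Pred (Fin n) 0ℓ → Set
    Apart X Y = ∀ v → X v → Y v → ⊥

    F-split : AllPairs Apart (𝓕 P) × AllPairs Apart (map tripleSet (𝓡 P) ++ W P ∷ []) ×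
              All (λ X → All (Apart X) (map tripleSet (𝓡 P) ++ W P ∷ [])) (𝓕 P)
    F-split = AllPairs-++⁻ (𝓕 P) (proj₁ (proj₂ (partition P)))

    R-split : AllPairs Apart (map tripleSet (𝓡 P)) × AllPairs Apart (W P ∷ []) ×
              All (λ X → All (Apart X) (W P ∷ [])) (map tripleSet (𝓡 P))
    R-split = AllPairs-++⁻ (map tripleSet (𝓡 P)) (proj₁ (proj₂ F-split))

    F-cross : ∀ p → All (Apart (F p)) (map tripleSet (𝓡 P) ++ W P ∷ [])
    F-cross = lookup-All (proj₂ (proj₂ F-split))

  F-unique : ∀ {v} p q → F p v → F q v → p ≡ q
  F-unique = disjoint⇒lookup-unique id (proj₁ F-split)

  R-unique : ∀ {v} j l → v ∈ₑ R j → v ∈ₑ R l → j ≡ l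
  R-unique = disjoint⇒lookup-unique tripleSet (AllPairsP.map⁻ (proj₁ R-split))

  F-R-disjoint : ∀ {v} p j → F p v → v ∈ₑ R j → ⊥
  F-R-disjoint p j = lookup-All (AllP.map⁻ (AllP.++⁻ˡ (map tripleSet (𝓡 P)) (F-cross p))) j _

  F-W-disjoint : ∀ {v} p → F p v → W P v → ⊥
  F-W-disjoint p = All.head (AllP.++⁻ʳ (map tripleSet (𝓡 P)) (F-cross p)) _

  R-W-disjoint : ∀ {v} j → v ∈ₑ R j → W P v → ⊥
  R-W-disjoint j = All.head (lookup-All (AllP.map⁻ (proj₂ (proj₂ R-split))) j) _

  R-transversal : ∀ j → Transversal (cls H) (R j)
  R-transversal = lookup-All (rClasses P)

  W-neighbour-edge : ∀ {w i} j → Adj H (R j) w → W P w → cls H w ≡ i →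
    ∃ λ e → e ∈ E H × e ≗ R j [ i ↦ w ]
  W-neighbour-edge {w} {i} j adj w∈W w-cls with find adj
  ... | e , e∈ , (_ , es≡w) , two
    with ContainsTwo⇒agrees-off-one (cls H) (edge-transversal H e∈) (R-transversal j) two
  ... | i* , agree with i ≟ i* | transversal-at (cls H) (edge-transversal H e∈) es≡w w-cls
  ... | yes refl | ei≡w = e , e∈ , agree , ei≡w
  ... | no i≢i*  | ei≡w = ⊥-elim (R-W-disjoint j (i , trans (sym (agree i i≢i*)) ei≡w) w∈W)

  record Selection (H′ : Tri3Graph n) : Set₁ where
    field
      class         : Fin nR → Fin 3
      new           : Fin nR → Fin n
      G             : Fin nF → Pred (Fin n) 0ℓ
      G⊆F           : ∀ {p v} → G p v → F p v
      new∉G         : ∀ p j → ¬ G p (new j)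
      new∉R         : ∀ j l t → t ≢ class l → new j ≢ R l t
      new-injective : Injective _≡_ _≡_ new
      F-edge        : ∀ p → ∃ λ e → e ∈ E H′ × ∀ t → G p (e t)
      R-edge        : ∀ j → ∃ λ e → e ∈ E H′ × e ≗ R j [ class j ↦ new j ]

  Selection⇒matching : ∀ {H′} → Selection H′ → ∃ λ M → IsMatching H′ M × length M ≡ nF + nR
  Selection⇒matching {H′} sel = family-matching H′ (edge ∘ splitAt nF) (edge∈ ∘ splitAt nF) disjoint
    where
    open Selection sel

    Label : Set
    Label = Fin nF ⊎ Fin nR

    edge : Label → Edge n
    edge = [ proj₁ ∘ F-edge , proj₁ ∘ R-edge ]′

    edge∈ : ∀ ℓ → edge ℓ ∈ E H′
    edge∈ (inj₁ p) = proj₁ (proj₂ (F-edge p))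
    edge∈ (inj₂ j) = proj₁ (proj₂ (R-edge j))

    Owns : Label → Pred (Fin n) 0ℓ
    Owns (inj₁ p) v = G p v
    Owns (inj₂ j) v = (∃ λ t → t ≢ class j × v ≡ R j t) ⊎ v ≡ new j

    owns-edge : ∀ ℓ t → Owns ℓ (edge ℓ t)
    owns-edge (inj₁ p) t = proj₂ (proj₂ (F-edge p)) t
    owns-edge (inj₂ j) t with t ≟ class j
    ... | yes refl = inj₂ (proj₂ (proj₂ (proj₂ (R-edge j))))
    ... | no t≢c   = inj₁ (t , t≢c , proj₁ (proj₂ (proj₂ (R-edge j))) t t≢c)

    G-unowned-by-R : ∀ {v} p j → G p v → ¬ Owns (inj₂ j) v
    G-unowned-by-R p j g (inj₁ (t , _ , v≡Rt)) = F-R-disjoint p j (G⊆F g) (t , sym v≡Rt)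
    G-unowned-by-R p j g (inj₂ v≡new)          = new∉G p j (subst (G p) v≡new g)

    owner-unique : ∀ {v} ℓ ℓ′ → Owns ℓ v → Owns ℓ′ v → ℓ ≡ ℓ′
    owner-unique (inj₁ p) (inj₁ q) g g′ = cong inj₁ (F-unique p q (G⊆F g) (G⊆F g′))
    owner-unique (inj₁ p) (inj₂ j) g o  = ⊥-elim (G-unowned-by-R p j g o)
    owner-unique (inj₂ j) (inj₁ p) o g  = ⊥-elim (G-unowned-by-R p j g o)
    owner-unique (inj₂ j) (inj₂ l) (inj₁ (t , _ , v≡)) (inj₁ (t′ , _ , v≡′)) =
      cong inj₂ (R-unique j l (t , sym v≡) (t′ , sym v≡′))
    owner-unique (inj₂ j) (inj₂ l) (inj₁ (t , t≢c , v≡)) (inj₂ v≡new) =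
      ⊥-elim (new∉R l j t t≢c (trans (sym v≡new) v≡))
    owner-unique (inj₂ j) (inj₂ l) (inj₂ v≡new) (inj₁ (t , t≢c , v≡)) =
      ⊥-elim (new∉R j l t t≢c (trans (sym v≡new) v≡))
    owner-unique (inj₂ j) (inj₂ l) (inj₂ v≡new) (inj₂ v≡new′) =
      cong inj₂ (new-injective (trans (sym v≡new) v≡new′))

    disjoint : ∀ {i j} → i ≢ j → Disjoint (edge (splitAt nF i)) (edge (splitAt nF j))
    disjoint {i} {j} i≢j s s′ eq = i≢j (trans (sym (join-splitAt nF nR i))
      (trans (cong (join nF nR) same-label) (join-splitAt nF nR j)))
      where
      same-label : splitAt nF i ≡ splitAt nF j
      same-label = owner-unique (splitAt nF i) (splitAt nF j) (owns-edge (splitAt nF i) s)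
                     (subst (Owns (splitAt nF j)) (sym eq) (owns-edge (splitAt nF j) s′))

module Saturation {n} {H : Tri3Graph n} (P : FRPartition H) (mt : Matchable H P) where
  open FRPartitionFacts P

  τ : Fin 3 → Fin nR → Fin n
  τ i = proj₁ (mt i)

  τ∈W : ∀ i j → W P (τ i j)
  τ∈W i j = proj₁ (proj₂ (proj₂ (mt i)) j)

  τ-cls : ∀ i j → cls H (τ i j) ≡ i
  τ-cls i j = proj₁ (proj₂ (proj₂ (proj₂ (proj₂ (mt i)) j)))

  τ-unique : ∀ {i i′ j l} → τ i j ≡ τ i′ l → j ≡ l
  τ-unique {i} {i′} {j} {l} eq with trans (sym (τ-cls i j)) (trans (cong (cls H) eq) (τ-cls i′ l))
  ... | refl = proj₁ (proj₂ (mt i)) eq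

  τ-adj : ∀ i j → Adj H (R j) (τ i j)
  τ-adj i j = proj₂ (proj₂ (proj₂ (proj₂ (proj₂ (mt i)) j)))

  τ-edge : ∀ i j → ∃ λ e → e ∈ E H × e ≗ R j [ i ↦ τ i j ]
  τ-edge i j = W-neighbour-edge j (τ-adj i j) (τ∈W i j) (τ-cls i j)

module Deletion {n} {H : Tri3Graph n} (P : FRPartition H) (mt : Matchable H P)
  (U : List (Fin n)) (U-classes : AllPairs (λ x y → cls H x ≢ cls H y) U)
  (F-avoiding : All (λ F → Any (λ e → e ⊆ₑ F × Avoids U e) (E H)) (𝓕 P))
  (R-avoiding : All (λ R → Any (λ e → ContainsTwo e R × Avoids U e) (E H)) (𝓡 P)) where
  open FRPartitionFacts P
  open Saturation P mt

  _∈U? : ∀ x → Dec (x ∈ U)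
  x ∈U? = DecMembership._∈?_ _≟_ x U

  U-cls-injective : ∀ {x y} → x ∈ U → y ∈ U → cls H x ≡ cls H y → x ≡ y
  U-cls-injective = AllPairs-≢⇒injective (cls H) U-classes

  ∈E−U : ∀ {e} → e ∈ E H → Avoids U e → e ∈ E (H − U)
  ∈E−U = ∈-filter⁺ (avoids? U)

  Good : Fin nR → Fin 3 → Set
  Good j i = (∀ t → t ≢ i → R j t ∉ U) × τ i j ∉ U

  good? : ∀ j i → Dec (Good j i)
  good? j i = all? (λ t → ¬? (t ≟ i) →-dec ¬? (R j t ∈U?)) ×-dec ¬? (τ i j ∈U?)

  good-selection : (∀ j → ∃ (Good j)) → Selection (H − U)
  good-selection good = record
    { class = class ; new = new ; G = F ; G⊆F = id
    ; new∉G = λ p j f → F-W-disjoint p f (τ∈W (class j) j)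
    ; new∉R = λ j l t _ new≡R → R-W-disjoint l (t , sym new≡R) (τ∈W (class j) j)
    ; new-injective = τ-unique
    ; F-edge = F-edge ; R-edge = R-edge }
    where
    class : Fin nR → Fin 3
    class = proj₁ ∘ good
    new : Fin nR → Fin n
    new j = τ (class j) j
    F-edge : ∀ p → ∃ λ e → e ∈ E (H − U) × ∀ t → F p (e t)
    F-edge p = let e , e∈ , e⊆F , avoids = find (lookup-All F-avoiding p) in e , ∈E−U e∈ avoids , e⊆F
    R-edge : ∀ j → ∃ λ e → e ∈ E (H − U) × e ≗ R j [ class j ↦ new j ]
    R-edge j = let e , e∈ , e≗ = τ-edge (class j) j
                   R-avoids , τ∉U = proj₂ (good j)
               in e , ∈E−U e∈ (replacement-avoids U e≗ R-avoids τ∉U) , e≗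

  module Exceptional (j₀ : Fin nR) (bad : ¬ ∃ (Good j₀)) where

    private
      found : ∃ λ e → e ∈ E H × ContainsTwo e (R j₀) × Avoids U e
      found = find (lookup-All R-avoiding j₀)

      e₀ : Edge n
      e₀ = proj₁ found

      e₀∈ : e₀ ∈ E H
      e₀∈ = proj₁ (proj₂ found)

      e₀-avoids : Avoids U e₀
      e₀-avoids = proj₂ (proj₂ (proj₂ found))

      agreement : ∃ λ i → ∀ t → t ≢ i → e₀ t ≡ R j₀ t
      agreement = ContainsTwo⇒agrees-off-one (cls H) (edge-transversal H e₀∈) (R-transversal j₀)
                    (proj₁ (proj₂ (proj₂ found)))

    i : Fin 3
    i = proj₁ agreement

    w : Fin n
    w = e₀ i

    w-cls : cls H w ≡ i
    w-cls = edge-transversal H e₀∈ i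

    R₀-avoids-off-i : ∀ t → t ≢ i → R j₀ t ∉ U
    R₀-avoids-off-i t t≢i = subst (_∉ U) (proj₂ agreement t t≢i) (e₀-avoids t)

    R₀-avoids : ∀ t → R j₀ t ∉ U
    R₀-avoids t with t ≟ i | τ i j₀ ∈U?
    ... | no t≢i   | _        = R₀-avoids-off-i t t≢i
    ... | yes refl | no τ∉U   = λ _ → bad (i , R₀-avoids-off-i , τ∉U)
    ... | yes refl | yes τ∈U  = λ R∈U → R-W-disjoint j₀
          (i , sym (U-cls-injective τ∈U R∈U (trans (τ-cls i j₀) (sym (R-transversal j₀ i))))) (τ∈W i j₀)

    τ₀∈U : ∀ i′ → τ i′ j₀ ∈ U
    τ₀∈U i′ with τ i′ j₀ ∈U?
    ... | yes τ∈U = τ∈U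
    ... | no τ∉U  = ⊥-elim (bad (i′ , (λ t _ → R₀-avoids t) , τ∉U))

    U⊆W : ∀ {x} → x ∈ U → W P x
    U⊆W {x} x∈U = subst (W P) τ≡x (τ∈W (cls H x) j₀)
      where
      τ≡x : τ (cls H x) j₀ ≡ x
      τ≡x = U-cls-injective (τ₀∈U (cls H x)) x∈U (τ-cls (cls H x) j₀)

    F∉U : ∀ {v} p → F p v → v ∉ U
    F∉U p f v∈U = F-W-disjoint p f (U⊆W v∈U)

    R∉U : ∀ j t → R j t ∉ U
    R∉U j t Rt∈U = R-W-disjoint j (t , refl) (U⊆W Rt∈U)

    τ∉U : ∀ {i′ j} → j ≢ j₀ → τ i′ j ∉ U
    τ∉U j≢j₀ τ∈U = j≢j₀ (τ-unique (U-cls-injective τ∈U (τ₀∈U _) (sym (τ-cls _ j₀))))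

    Choice : Fin nR → Fin 3 → Fin n → Set
    Choice j c x = (j ≡ j₀ × c ≡ i × x ≡ w) ⊎ (j ≢ j₀ × x ≡ τ c j × x ≢ w × (c ≡ i ⊎ W P w))

    -- If τᵢ(j) is w itself, R j uses another class instead: its τ-vertex then
    -- differs from w by class, and w ∈ W keeps w out of every R.
    choose : ∀ j → Σ (Fin 3) λ c → Σ (Fin n) (Choice j c)
    choose j with j ≟ j₀ | τ i j ≟ w
    ... | yes j≡j₀ | _      = i , w , inj₁ (j≡j₀ , refl , refl)
    ... | no j≢j₀  | no τ≢w = i , τ i j , inj₂ (j≢j₀ , refl , τ≢w , inj₁ refl)
    ... | no j≢j₀  | yes τ≡w =
      punchIn i zero , τ (punchIn i zero) j ,
      inj₂ (j≢j₀ , refl , other≢w , inj₂ (subst (W P) τ≡w (τ∈W i j)))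
      where
      other≢w : τ (punchIn i zero) j ≢ w
      other≢w eq = punchInᵢ≢i i zero (trans (sym (τ-cls _ j)) (trans (cong (cls H) eq) w-cls))

    class : Fin nR → Fin 3
    class j = proj₁ (choose j)

    new : Fin nR → Fin n
    new j = proj₁ (proj₂ (choose j))

    choice : ∀ j → Choice j (class j) (new j)
    choice j = proj₂ (proj₂ (choose j))

    ≡τ⇒∈W : ∀ {j c x} → x ≡ τ c j → W P x
    ≡τ⇒∈W {j} {c} x≡τ = subst (W P) (sym x≡τ) (τ∈W c j)

    class≡i : ∀ l → ¬ W P w → class l ≡ i
    class≡i l w∉W with choice l
    ... | inj₁ (_ , c≡i , _)                = c≡i
    ... | inj₂ (_ , _ , _ , inj₁ c≡i)       = c≡i
    ... | inj₂ (_ , _ , _ , inj₂ w∈W)       = ⊥-elim (w∉W w∈W)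

    new∉G : ∀ p j → ¬ (F p (new j) × new j ≢ w)
    new∉G p j (f , new≢w) with choice j
    ... | inj₁ (_ , _ , new≡w)         = new≢w new≡w
    ... | inj₂ (_ , new≡τ , _)         = F-W-disjoint p f (≡τ⇒∈W new≡τ)

    new∉R : ∀ j l t → t ≢ class l → new j ≢ R l t
    new∉R j l t t≢c new≡R with choice j
    ... | inj₂ (_ , new≡τ , _) = R-W-disjoint l (t , sym new≡R) (≡τ⇒∈W new≡τ)
    ... | inj₁ (_ , _ , new≡w) = t≢c (trans t≡i (sym (class≡i l (R-W-disjoint l (t , sym w≡R)))))
      where
      w≡R : w ≡ R l t
      w≡R = trans (sym new≡w) new≡R
      t≡i : t ≡ i
      t≡i = trans (sym (R-transversal l t)) (trans (cong (cls H) (sym w≡R)) w-cls)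

    new-injective : Injective _≡_ _≡_ new
    new-injective {j} {l} eq with choice j | choice l
    ... | inj₁ (j≡j₀ , _)          | inj₁ (l≡j₀ , _)          = trans j≡j₀ (sym l≡j₀)
    ... | inj₁ (_ , _ , new≡w)     | inj₂ (_ , _ , new≢w , _) = ⊥-elim (new≢w (trans (sym eq) new≡w))
    ... | inj₂ (_ , _ , new≢w , _) | inj₁ (_ , _ , new≡w)     = ⊥-elim (new≢w (trans eq new≡w))
    ... | inj₂ (_ , new≡τ , _)     | inj₂ (_ , new≡τ′ , _)    = τ-unique (trans (sym new≡τ) (trans eq new≡τ′))

    F-edge : ∀ p → ∃ λ e → e ∈ E (H − U) × ∀ t → F p (e t) × e t ≢ w
    F-edge p =
      let e , e∈ , e⊆F , e∌w = truncMultiFano-avoiding {H = H} (lookup-All (fano P) p) w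
      in e , ∈E−U e∈ (λ t → F∉U p (e⊆F t)) , λ t → e⊆F t , e∌w t

    R-edge : ∀ j → ∃ λ e → e ∈ E (H − U) × e ≗ R j [ class j ↦ new j ]
    R-edge j with choice j
    ... | inj₁ (refl , c≡i , new≡w) =
      e₀ , ∈E−U e₀∈ e₀-avoids ,
      subst₂ (λ c x → e₀ ≗ R j₀ [ c ↦ x ]) (sym c≡i) (sym new≡w) (proj₂ agreement , refl)
    ... | inj₂ (j≢j₀ , new≡τ , _) =
      let e , e∈ , e≗ = τ-edge (class j) j
      in e , ∈E−U e∈ (replacement-avoids U e≗ (λ t _ → R∉U j t) (τ∉U j≢j₀)) ,
         subst (λ x → e ≗ R j [ class j ↦ x ]) (sym new≡τ) e≗

    selection : Selection (H − U)
    selection = record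
      { class = class ; new = new ; G = λ p v → F p v × v ≢ w ; G⊆F = proj₁
      ; new∉G = new∉G ; new∉R = new∉R ; new-injective = new-injective
      ; F-edge = F-edge ; R-edge = R-edge }

  matching-avoiding-U : ∃ λ M → IsMatching (H − U) M × length M ≡ nF + nR
  matching-avoiding-U with all? (λ j → any? (good? j))
  ... | yes good = Selection⇒matching (good-selection good)
  ... | no ¬good =
    let j₀ , bad = ¬∀⟶∃¬ nR _ (λ j → any? (good? j)) ¬good
    in Selection⇒matching (Exceptional.selection j₀ bad)

lemma3p5 : ∀ {n : ℕ} (H : Tri3Graph n) (P : FRPartition H) → Matchable H P →
    (a b c : Fin n) → V H a → V H b → V H c →
    cls H a ≢ cls H b → cls H a ≢ cls H c → cls H b ≢ cls H c →
    All (λ F → Any (λ e → e ⊆ₑ F × Avoids (a ∷ b ∷ c ∷ []) e) (E H)) (𝓕 P) →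
    All (λ R → Any (λ e → ContainsTwo e R × Avoids (a ∷ b ∷ c ∷ []) e) (E H)) (𝓡 P) →
    ∀ k → MatchingNumber H k → MatchingNumber (H − (a ∷ b ∷ c ∷ [])) k
-- The argument never uses that a, b, c are vertices of H.
lemma3p5 H P mt a b c _ _ _ a≁b a≁c b≁c F-avoiding R-avoiding k ν≡k =
  MatchingNumber-− {H = H} {U} ν≡k (subst (λ m → ∃ λ M → IsMatching (H − U) M × length M ≡ m)
                               (MatchingNumber-unique {H = H} (size P) ν≡k) large-matching)
  where
  U : List (Fin _)
  U = a ∷ b ∷ c ∷ []
  large-matching : ∃ λ M → IsMatching (H − U) M × length M ≡ length (𝓕 P) + length (𝓡 P)
  large-matching = Deletion.matching-avoiding-U P mt U
                     ((a≁b ∷ a≁c ∷ []) ∷ (b≁c ∷ []) ∷ [] ∷ []) F-avoiding R-avoiding
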